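{- There are functions $\mathsf{wk}_{S'}$ (for each sequent $S'$), $\mathsf{contr}_{p^\bullet}$, $\mathsf{contr}_{p^\circ}$ (for each propositional variable $p$), $\mathsf{inv}_{\bot^\circ}$, $\mathsf{linv}_{\phi\to\psi^\bullet}$, $\mathsf{rinv}_{\phi\to\psi^\bullet}$, $\mathsf{inv}_{\phi\to\psi^\circ}$, $\mathsf{inv}_{\Box\phi^\circ}$ (for all formulas $\phi,\psi$), each mapping proofs in $(\mathsf{Grz}+\mathsf{cut})^\infty$ to proofs in $(\mathsf{Grz}+\mathsf{cut})^\infty$, such that for all sequents $S$: (i) if $\pi\vdash S$ then $\mathsf{wk}_{S'}(\pi)\vdash S\cup S'$; (ii) if $\pi\vdash S,p^\bullet,p^\bullet$ then $\mathsf{contr}_{p^\bullet}(\pi)\vdash S,p^\bullet$; (iii) if $\pi\vdash S,p^\circ,p^\circ$ then $\mathsf{contr}_{p^\circ}(\pi)\vdash S,p^\circ$; (iv) if $\pi\vdash S,\bot^\circ$ then $\mathsf{inv}_{\bot^\circ}(\pi)\vdash S$; (v) if $\pi\vdash S,(\phi\to\psi)^\bullet$ then $\mathsf{linv}_{\phi\to\psi^\bullet}(\pi)\vdash S,\phi^\circ$ and $\mathsf{rinv}_{\phi\to\psi^\bullet}(\pi)\vdash S,\psi^\bullet$; (vi) if $\pi\vdash S,(\phi\to\psi)^\circ$ then $\mathsf{inv}_{\phi\to\psi^\circ}(\pi)\vdash S,\phi^\bullet,\psi^\circ$; (vii) if $\pi\vdash S,\Box\phi^\circ$ then $\mathsf{inv}_{\Box\phi^\circ}(\pi)\vdash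 S,\phi^\circ$; (viii) all these functions preserve local height and preserve freeness of cuts in the main fragment.
   Context: Formulas are built from propositional variables, $\bot$, $\to$, $\Box$. A sequent is a pair $(\Gamma,\Delta)$ of finite multisets of formulas; $S_0\cup S_1$ is componentwise multiset union; $S,\phi^\bullet$ means $S\cup(\{\phi\},\varnothing)$, $S,\phi^\circ$ means $S\cup(\varnothing,\{\phi\})$, similarly $S,\Gamma^\bullet$, $S,\Gamma^\circ$ for multisets; $\Box\Pi=\{\Box\psi:\psi\in\Pi\}$. Rules (premises in order $0,1$): (Ax) conclusion $S,p^\bullet,p^\circ$, no premises; ($\bot^\bullet$) conclusion $S,\bot^\bullet$, no premises; ($\to^\bullet$) premises $S,\phi^\circ$ and $S,\psi^\bullet$, conclusion $S,(\phi\to\psi)^\bullet$; ($\to^\circ$) premise $S,\phi^\bullet,\psi^\circ$, conclusion $S,(\phi\to\psi)^\circ$; (Refl) premise $S,\phi^\bullet,\Box\phi^\bullet$, conclusion $S,\Box\phi^\bullet$; ($\Box$) premises $S,\Box\Pi^\bullet,\phi^\circ$ and $\Box\Pi^\bullet,\phi^\circ$, conclusion $S,\Box\Pi^\bullet,\Box\phi^\circ$; (cut) premises $S,\phi^\circ$ and $S,\phi^\bullet$, conclusion $S$. A proof in $(\mathsf{Grz}+\mathsf{cut})^\infty$ is a finitely branching, possibly infinite tree (nodes are words over $\mathbb{N}$, children of $w$ are $w0,w1,\dots$) labelled by a sequent and one of these rules, such that each node with its children forms an instance of its rule, and every infinite branch passes infinitely often through a node that is the right premise (child $1$) of a $(\Box)$-instance.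 $\pi\vdash S$ means $\pi$ is such a proof whose root sequent is $S$. The main fragment of $\pi$ consists of the nodes $w$ such that no node $u$ with $\epsilon\neq u\sqsubseteq w$ is the right premise of a $(\Box)$-instance, together with (as its non-wellfounded leaves) the right premises of $(\Box)$-instances at nodes in that set; it is finite. The local height of $\pi$ is the height of its main fragment. A function $f$ on proofs preserves local height if the local height of $f(\pi)$ is at most that of $\pi$, and preserves freeness of cuts in the main fragment if whenever no node of the main fragment of $\pi$ (other than its non-wellfounded leaves) is labelled with (cut), the same holds for $f(\pi)$. -}

module Defs where

open import Data.Nat using (ℕ; zero; suc; _≤_; _<_)
open import Data.List using (List; []; _∷_; _++_; _∷ʳ_; map; length)
open import Data.List.Relation.Binary.Permutation.Propositional using (_↭_)
open import Data.Product using (Σ; ∃; _×_; _,_)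
open import Data.Sum using (_⊎_)
open import Relation.Binary.PropositionalEquality using (_≡_; _≢_)
open import Relation.Nullary using (¬_)

data Fm : Set where
  var  : ℕ → Fm
  ⊥'   : Fm
  _⇒_  : Fm → Fm → Fm
  □_   : Fm → Fm

infixr 6 _⇒_
infix  7 □_

-- Sequents: pairs of finite multisets, represented by lists,
-- with multiset equality given by permutation (_↭_) componentwise.

record Sequent : Set where
  constructor ⟨_∣_⟩
  field
    ante : List Fm
    succ : List Fm
open Sequent public

_≈ₛ_ : Sequent → Sequent → Set
S ≈ₛ T = (ante S ↭ ante T) × (succ S ↭ succ T)

_∪ₛ_ : Sequent → Sequent → Sequent
S ∪ₛ T = ⟨ ante S ++ ante T ∣ succ S ++ succ T ⟩

_,•_ : Sequent → Fm → Sequent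
S ,• φ = ⟨ φ ∷ ante S ∣ succ S ⟩

_,∘_ : Sequent → Fm → Sequent
S ,∘ φ = ⟨ ante S ∣ φ ∷ succ S ⟩

infixl 5 _,•_ _,∘_

□* : List Fm → List Fm
□* Π = map □_ Π

data Rule : Set where
  Ax ⊥• →• →∘ Refl Box Cut : Rule

arity : Rule → ℕ
arity Ax   = 0
arity ⊥•   = 0
arity →•   = 2
arity →∘   = 1
arity Refl = 1
arity Box  = 2
arity Cut  = 2

-- Preproofs: trees whose nodes are words over ℕ (lists, the child i of
-- w being  w ∷ʳ i), labelled by a sequent and a rule.  The labelling is
-- a total function on words; only the nodes of the tree (determined by
-- the arities of the rules) matter.

record Preproof : Set where
  field
    seq  : List ℕ → Sequent
    rule : List ℕ → Rule
open Preproof public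

data Node (π : Preproof) : List ℕ → Set where
  root  : Node π []
  child : ∀ {w i} → Node π w → i < arity (rule π w) → Node π (w ∷ʳ i)

Instance : Preproof → List ℕ → Set
Instance π w with rule π w
... | Ax   = Σ Sequent λ S → Σ ℕ λ p →
               seq π w ≈ₛ (S ,• var p ,∘ var p)
... | ⊥•   = Σ Sequent λ S → seq π w ≈ₛ (S ,• ⊥')
... | →•   = Σ Sequent λ S → Σ Fm λ φ → Σ Fm λ ψ →
               (seq π w ≈ₛ (S ,• (φ ⇒ ψ)))
             × (seq π (w ∷ʳ 0) ≈ₛ (S ,∘ φ))
             × (seq π (w ∷ʳ 1) ≈ₛ (S ,• ψ))
... | →∘   = Σ Sequent λ S → Σ Fm λ φ → Σ Fm λ ψ →
               (seq π w ≈ₛ (S ,∘ (φ ⇒ ψ)))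
             × (seq π (w ∷ʳ 0) ≈ₛ (S ,• φ ,∘ ψ))
... | Refl = Σ Sequent λ S → Σ Fm λ φ →
               (seq π w ≈ₛ (S ,• □ φ))
             × (seq π (w ∷ʳ 0) ≈ₛ (S ,• φ ,• □ φ))
... | Box  = Σ Sequent λ S → Σ (List Fm) λ Π → Σ Fm λ φ →
               (seq π w ≈ₛ ((S ∪ₛ ⟨ □* Π ∣ [] ⟩) ,∘ □ φ))
             × (seq π (w ∷ʳ 0) ≈ₛ ((S ∪ₛ ⟨ □* Π ∣ [] ⟩) ,∘ φ))
             × (seq π (w ∷ʳ 1) ≈ₛ (⟨ □* Π ∣ [] ⟩ ,∘ φ))
... | Cut  = Σ Sequent λ S → Σ Fm λ φ →
               (seq π w ≈ₛ S)
             × (seq π (w ∷ʳ 0) ≈ₛ (S ,∘ φ))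
             × (seq π (w ∷ʳ 1) ≈ₛ (S ,• φ))

RightBoxPrem : Preproof → List ℕ → Set
RightBoxPrem π w = Σ (List ℕ) λ u → (w ≡ u ∷ʳ 1) × (rule π u ≡ Box)

pref : (ℕ → ℕ) → ℕ → List ℕ
pref β zero    = []
pref β (suc n) = pref β n ∷ʳ β n

IsBranch : Preproof → (ℕ → ℕ) → Set
IsBranch π β = ∀ n → Node π (pref β n)

Fair : Preproof → (ℕ → ℕ) → Set
Fair π β = ∀ n → Σ ℕ λ m → (n ≤ m) × RightBoxPrem π (pref β m)

record Proof : Set where
  field
    tree     : Preproof
    locallyOK : ∀ w → Node tree w → Instance tree w
    fair     : ∀ β → IsBranch tree β → Fair tree β
open Proof public

_⊢_ : Proof → Sequent → Set
π ⊢ S = seq (tree π) [] ≈ₛ S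

infix 4 _⊢_

-- w is a (non-leaf) node of the main fragment: no u with ε ≠ u ⊑ w is a
-- right premise of a (□)-instance  (RightBoxPrem already forces u ≠ ε)
MainInner : Proof → List ℕ → Set
MainInner π w = Node (tree π) w
              × (∀ u v → u ++ v ≡ w → ¬ RightBoxPrem (tree π) u)

-- nodes of the main fragment, including its non-wellfounded leaves
MainNode : Proof → List ℕ → Set
MainNode π w = MainInner π w
             ⊎ Σ (List ℕ) λ u → (w ≡ u ∷ʳ 1) × MainInner π u
                                × (rule (tree π) u ≡ Box)

LocalHeight≤ : Proof → ℕ → Set
LocalHeight≤ π k = ∀ w → MainNode π w → length w ≤ k

MainCutFree : Proof → Set
MainCutFree π = ∀ w → MainInner π w → rule (tree π) w ≢ Cut

PreservesLocalHeight : (Proof → Proof) → Set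
PreservesLocalHeight f = ∀ π k → LocalHeight≤ π k → LocalHeight≤ (f π) k

PreservesMainCutFree : (Proof → Proof) → Set
PreservesMainCutFree f = ∀ π → MainCutFree π → MainCutFree (f π)

Preserves : (Proof → Proof) → Set
Preserves f = PreservesLocalHeight f × PreservesMainCutFree f

-- All eight maps are instances of one construction.  Fix sequents D ⊑ R and A and put
-- T C = A ∪ (C ∖ D).  If the root sequent of π contains R, relabel π node by node with T
-- of its sequent.  As long as the principal formulas of an inference leave R in its context,
-- the relabelled node is again an instance of the same rule over the relabelled premises.
-- The relabelling is not propagated into right premises of (□), which do not carry the
-- context, and when a premise already proves the relabelled conclusion (which is what
-- happens when the principal formula is the inverted one), the inference is skipped and the
-- subproof of that premise is reused unchanged.  So each node of the new proof sits over a
-- node of π that is at least as deep and carries the same rule: the main fragment maps into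
-- that of π, which bounds the local height and keeps it cut-free, and infinite branches map
-- to infinite branches through the same right premises of (□).

module Submission where

open import Defs
open import Data.Bool as Bool using (Bool; true; false; if_then_else_)
open import Data.List using (List; []; _∷_; [_]; _++_; _∷ʳ_; length; filter; foldl)
open import Data.List.Properties
  using ( length-++; filter-++; filter-accept; filter-reject; ∷-injective; ∷ʳ-injective
        ; ++-assoc; ++-identityʳ; ++-conicalˡ; ++-conicalʳ; ∷ʳ-++; foldl-∷ʳ )
open import Data.List.Relation.Binary.Permutation.Propositional
  using (_↭_; ↭-refl; ↭-sym; ↭-trans; ↭-prep; ↭-swap; ↭-reflexive)
open import Data.List.Relation.Binary.Permutation.Propositional.Properties
  using (↭-length; filter-↭; ++⁺ˡ; ++-comm; shifts)
open import Data.Nat as ℕ using (ℕ; zero; suc; _+_; _∸_; _≤_; _<_; z≤n; s≤s)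
open import Data.Nat.Properties hiding (_≟_)
open import Data.Product using (Σ; ∃; _×_; _,_; proj₁; proj₂)
open import Data.Sum using (_⊎_; inj₁; inj₂)
open import Function using (_∘_; id)
open import Relation.Binary.Definitions using (DecidableEquality)
open import Relation.Binary.PropositionalEquality hiding ([_])
open import Relation.Nullary using (Dec; yes; no; ¬_; does; contradiction)
open import Relation.Nullary.Decidable using (map′; _×-dec_)

-- Multisets as lists compared by multiplicities

module Multiset {A : Set} (_≟_ : DecidableEquality A) where

  infix 4 _⊑_ _⊑?_ _↭?_
  infixl 6 _∖_

  count : A → List A → ℕ
  count y = length ∘ filter (y ≟_)

  count-++ : ∀ y xs ys → count y (xs ++ ys) ≡ count y xs + count y ys
  count-++ y xs ys = trans (cong length (filter-++ (y ≟_) xs ys)) (length-++ (filter (y ≟_) xs))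

  count-≡ : ∀ x xs → count x (x ∷ xs) ≡ suc (count x xs)
  count-≡ x xs = cong length (filter-accept (x ≟_) refl)

  count-≢ : ∀ {y x} xs → y ≢ x → count y (x ∷ xs) ≡ count y xs
  count-≢ xs y≢x = cong length (filter-reject (_ ≟_) y≢x)

  count-resp-↭ : ∀ {xs ys} → xs ↭ ys → ∀ y → count y xs ≡ count y ys
  count-resp-↭ p y = ↭-length (filter-↭ (y ≟_) p)

  record _⊑_ (xs ys : List A) : Set where
    constructor by-count
    field count-mono : ∀ y → count y xs ≤ count y ys
  open _⊑_ public

  del : A → List A → List A
  del x []       = []
  del x (y ∷ ys) = if does (x ≟ y) then ys else y ∷ del x ys

  _∖_ : List A → List A → List A
  xs ∖ []       = xs
  xs ∖ (y ∷ ys) = del y xs ∖ ys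

  del-≢ : ∀ {x y} ys → x ≢ y → del x (y ∷ ys) ≡ y ∷ del x ys
  del-≢ {x} {y} ys x≢y with x ≟ y
  ... | yes x≡y = contradiction x≡y x≢y
  ... | no _    = refl

  count-del-≡ : ∀ x ys → count x (del x ys) ≡ count x ys ∸ 1
  count-del-≡ x []       = refl
  count-del-≡ x (y ∷ ys) with x ≟ y
  ... | yes refl = refl
  ... | no x≢y   = trans (count-≢ (del x ys) x≢y) (count-del-≡ x ys)

  count-del-≢ : ∀ {z x} ys → z ≢ x → count z (del x ys) ≡ count z ys
  count-del-≢         []       z≢x = refl
  count-del-≢ {z} {x} (y ∷ ys) z≢x with x ≟ y
  ... | yes refl = sym (count-≢ ys z≢x)
  ... | no _     = begin
    count z (y ∷ del x ys)              ≡⟨ count-++ z [ y ] (del x ys) ⟩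
    count z [ y ] + count z (del x ys)  ≡⟨ cong (count z [ y ] +_) (count-del-≢ ys z≢x) ⟩
    count z [ y ] + count z ys          ≡⟨ count-++ z [ y ] ys ⟨
    count z (y ∷ ys)                    ∎
    where open ≡-Reasoning

  count-∖ : ∀ z xs ys → count z (xs ∖ ys) ≡ count z xs ∸ count z ys
  count-∖ z xs []       = refl
  count-∖ z xs (y ∷ ys) with z ≟ y
  ... | yes refl = begin
    count z (del z xs ∖ ys)          ≡⟨ count-∖ z (del z xs) ys ⟩
    count z (del z xs) ∸ count z ys  ≡⟨ cong (_∸ count z ys) (count-del-≡ z xs) ⟩
    count z xs ∸ 1 ∸ count z ys      ≡⟨ ∸-+-assoc (count z xs) 1 (count z ys) ⟩
    count z xs ∸ suc (count z ys)    ∎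
    where open ≡-Reasoning
  ... | no z≢y = trans (count-∖ z (del y xs) ys) (cong (_∸ count z ys) (count-del-≢ xs z≢y))

  del-↭ : ∀ x ys → 0 < count x ys → ys ↭ x ∷ del x ys
  del-↭ x (y ∷ ys) x∈ys with x ≟ y
  ... | yes refl = ↭-refl
  ... | no _     = ↭-trans (↭-prep y (del-↭ x ys x∈ys)) (↭-swap y x ↭-refl)

  count≡⇒↭ : ∀ xs ys → (∀ y → count y xs ≡ count y ys) → xs ↭ ys
  count≡⇒↭ []       []       _  = ↭-refl
  count≡⇒↭ []       (y ∷ ys) eq = contradiction (trans (eq y) (count-≡ y ys)) λ ()
  count≡⇒↭ (x ∷ xs) ys       eq =
    ↭-trans (↭-prep x (count≡⇒↭ xs (del x ys) eq′)) (↭-sym (del-↭ x ys x∈ys))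
    where
    x∈ys : 0 < count x ys
    x∈ys = subst (0 <_) (trans (sym (count-≡ x xs)) (eq x)) (s≤s z≤n)
    eq′ : ∀ z → count z xs ≡ count z (del x ys)
    eq′ z with z ≟ x
    ... | yes refl = trans (cong (_∸ 1) (trans (sym (count-≡ z xs)) (eq z))) (sym (count-del-≡ z ys))
    ... | no z≢x   = trans (sym (count-≢ xs z≢x)) (trans (eq z) (sym (count-del-≢ ys z≢x)))

  ∖≡[]⇒⊑ : ∀ xs ys → xs ∖ ys ≡ [] → xs ⊑ ys
  ∖≡[]⇒⊑ xs ys eq = by-count λ y → m∸n≡0⇒m≤n (trans (sym (count-∖ y xs ys)) (cong (count y) eq))

  _⊑?_ : ∀ xs ys → Dec (xs ⊑ ys)
  xs ⊑? ys with xs ∖ ys in eq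
  ... | []     = yes (∖≡[]⇒⊑ xs ys eq)
  ... | z ∷ zs = no λ xs⊑ys → contradiction (begin
    suc (count z zs)         ≡⟨ count-≡ z zs ⟨
    count z (z ∷ zs)         ≡⟨ cong (count z) eq ⟨
    count z (xs ∖ ys)        ≡⟨ count-∖ z xs ys ⟩
    count z xs ∸ count z ys  ≡⟨ m≤n⇒m∸n≡0 (count-mono xs⊑ys z) ⟩
    0                        ∎) λ ()
    where open ≡-Reasoning

  ⊑-antisym : ∀ {xs ys} → xs ⊑ ys → ys ⊑ xs → xs ↭ ys
  ⊑-antisym xs⊑ys ys⊑xs = count≡⇒↭ _ _ λ y → ≤-antisym (count-mono xs⊑ys y) (count-mono ys⊑xs y)

  ↭⇒⊑ : ∀ {xs ys} → xs ↭ ys → xs ⊑ ys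
  ↭⇒⊑ p = by-count λ y → ≤-reflexive (count-resp-↭ p y)

  _↭?_ : ∀ xs ys → Dec (xs ↭ ys)
  xs ↭? ys = map′ (λ (l , r) → ⊑-antisym l r) (λ p → ↭⇒⊑ p , ↭⇒⊑ (↭-sym p))
                  (xs ⊑? ys ×-dec ys ⊑? xs)

  ⊑-refl : ∀ {xs} → xs ⊑ xs
  ⊑-refl = by-count λ _ → ≤-refl

  []⊑ : ∀ {xs} → [] ⊑ xs
  []⊑ = by-count λ _ → z≤n

  ⊑-trans : ∀ {xs ys zs} → xs ⊑ ys → ys ⊑ zs → xs ⊑ zs
  ⊑-trans xs⊑ys ys⊑zs = by-count λ y → ≤-trans (count-mono xs⊑ys y) (count-mono ys⊑zs y)

  ⊑-++ʳ : ∀ xs zs → xs ⊑ xs ++ zs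
  ⊑-++ʳ xs zs = by-count λ y → ≤-trans (m≤m+n (count y xs) (count y zs)) (≤-reflexive (sym (count-++ y xs zs)))

  ⊑-++ˡ : ∀ {xs ys} zs → xs ⊑ ys → xs ⊑ zs ++ ys
  ⊑-++ˡ {ys = ys} zs xs⊑ys = by-count λ y →
    ≤-trans (count-mono xs⊑ys y) (≤-trans (m≤n+m _ (count y zs)) (≤-reflexive (sym (count-++ y zs ys))))

  ⊑-del-≢ : ∀ {x y} → x ≢ y → [ y ] ⊑ del x [ y ]
  ⊑-del-≢ x≢y = subst ([ _ ] ⊑_) (sym (del-≢ [] x≢y)) ⊑-refl

  ⊑-del-pair : ∀ x y → [ x ] ⊑ del y (x ∷ [ x ])
  ⊑-del-pair x y with y ≟ x
  ... | yes _ = ⊑-refl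
  ... | no _  = ⊑-++ʳ [ x ] [ x ]

  ∖-resp-↭ : ∀ {xs ys} ds → xs ↭ ys → xs ∖ ds ↭ ys ∖ ds
  ∖-resp-↭ {xs} {ys} ds p = count≡⇒↭ _ _ λ y → begin
    count y (xs ∖ ds)        ≡⟨ count-∖ y xs ds ⟩
    count y xs ∸ count y ds  ≡⟨ cong (_∸ count y ds) (count-resp-↭ p y) ⟩
    count y ys ∸ count y ds  ≡⟨ count-∖ y ys ds ⟨
    count y (ys ∖ ds)        ∎
    where open ≡-Reasoning

  ++-∖-cancelˡ : ∀ ds ss → (ds ++ ss) ∖ ds ↭ ss
  ++-∖-cancelˡ ds ss = count≡⇒↭ _ _ λ y → begin
    count y ((ds ++ ss) ∖ ds)             ≡⟨ count-∖ y (ds ++ ss) ds ⟩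
    count y (ds ++ ss) ∸ count y ds       ≡⟨ cong (_∸ count y ds) (count-++ y ds ss) ⟩
    count y ds + count y ss ∸ count y ds  ≡⟨ m+n∸m≡n (count y ds) (count y ss) ⟩
    count y ss                            ∎
    where open ≡-Reasoning

  ++-∖-assoc : ∀ qs {ss ds} → ds ⊑ ss → (qs ++ ss) ∖ ds ↭ qs ++ (ss ∖ ds)
  ++-∖-assoc qs {ss} {ds} ds⊑ss = count≡⇒↭ _ _ λ y → begin
    count y ((qs ++ ss) ∖ ds)               ≡⟨ count-∖ y (qs ++ ss) ds ⟩
    count y (qs ++ ss) ∸ count y ds         ≡⟨ cong (_∸ count y ds) (count-++ y qs ss) ⟩
    count y qs + count y ss ∸ count y ds    ≡⟨ +-∸-assoc (count y qs) (count-mono ds⊑ss y) ⟩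
    count y qs + (count y ss ∸ count y ds)  ≡⟨ cong (count y qs +_) (count-∖ y ss ds) ⟨
    count y qs + count y (ss ∖ ds)          ≡⟨ count-++ y qs (ss ∖ ds) ⟨
    count y (qs ++ (ss ∖ ds))               ∎
    where open ≡-Reasoning

  ⊑-∖-cancelˡ : ∀ {rs qs ss xs} → rs ⊑ qs ++ ss → xs ⊑ rs ∖ qs → xs ⊑ ss
  ⊑-∖-cancelˡ {rs} {qs} {ss} {xs} rs⊑qs++ss xs⊑rs∖qs = by-count λ y → begin
    count y xs                            ≤⟨ count-mono xs⊑rs∖qs y ⟩
    count y (rs ∖ qs)                     ≡⟨ count-∖ y rs qs ⟩
    count y rs ∸ count y qs               ≤⟨ ∸-monoˡ-≤ (count y qs) (count-mono rs⊑qs++ss y) ⟩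
    count y (qs ++ ss) ∸ count y qs       ≡⟨ cong (_∸ count y qs) (count-++ y qs ss) ⟩
    count y qs + count y ss ∸ count y qs  ≡⟨ m+n∸m≡n (count y qs) (count y ss) ⟩
    count y ss                            ∎
    where open ≤-Reasoning

-- Formulas and sequents

infix 4 _≟_ _⊑ₛ_
infixl 6 _∖ₛ_

_≟_ : DecidableEquality Fm
var m   ≟ var n   = map′ (cong var) (λ { refl → refl }) (m ℕ.≟ n)
⊥'      ≟ ⊥'      = yes refl
(a ⇒ b) ≟ (c ⇒ d) = map′ (λ { (refl , refl) → refl }) (λ { refl → refl , refl }) (a ≟ c ×-dec b ≟ d)
(□ a)   ≟ (□ b)   = map′ (cong □_) (λ { refl → refl }) (a ≟ b)
var _   ≟ ⊥'      = no λ ()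
var _   ≟ (_ ⇒ _) = no λ ()
var _   ≟ (□ _)   = no λ ()
⊥'      ≟ var _   = no λ ()
⊥'      ≟ (_ ⇒ _) = no λ ()
⊥'      ≟ (□ _)   = no λ ()
(_ ⇒ _) ≟ var _   = no λ ()
(_ ⇒ _) ≟ ⊥'      = no λ ()
(_ ⇒ _) ≟ (□ _)   = no λ ()
(□ _)   ≟ var _   = no λ ()
(□ _)   ≟ ⊥'      = no λ ()
(□ _)   ≟ (_ ⇒ _) = no λ ()

open Multiset _≟_

BoxFree : List Fm → Set
BoxFree xs = ∀ φ → count (□ φ) xs ≡ 0

count-□*-unboxed : ∀ {y} Π → (∀ φ → y ≢ □ φ) → count y (□* Π) ≡ 0
count-□*-unboxed []      _       = refl
count-□*-unboxed (φ ∷ Π) unboxed = trans (count-≢ (□* Π) (unboxed φ)) (count-□*-unboxed Π unboxed)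

BoxFree⇒⊑∖□* : ∀ {xs} Π → BoxFree xs → xs ⊑ xs ∖ □* Π
BoxFree⇒⊑∖□* {xs} Π boxFree = by-count λ y → ≤-reflexive (sym (trans (count-∖ y xs (□* Π)) (unaffected y)))
  where
  unaffected : ∀ y → count y xs ∸ count y (□* Π) ≡ count y xs
  unaffected (□ φ)   rewrite boxFree φ = 0∸n≡0 (count (□ φ) (□* Π))
  unaffected (var _) = cong (count (var _) xs ∸_) (count-□*-unboxed Π λ _ ())
  unaffected ⊥'      = cong (count ⊥' xs ∸_) (count-□*-unboxed Π λ _ ())
  unaffected (_ ⇒ _) = cong (count (_ ⇒ _) xs ∸_) (count-□*-unboxed Π λ _ ())

_⊑ₛ_ : Sequent → Sequent → Set
S ⊑ₛ S′ = ante S ⊑ ante S′ × succ S ⊑ succ S′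

_∖ₛ_ : Sequent → Sequent → Sequent
S ∖ₛ D = ⟨ ante S ∖ ante D ∣ succ S ∖ succ D ⟩

≈ₛ-refl : ∀ {S} → S ≈ₛ S
≈ₛ-refl = ↭-refl , ↭-refl

≈ₛ-reflexive : ∀ {S S′} → S ≡ S′ → S ≈ₛ S′
≈ₛ-reflexive refl = ≈ₛ-refl

≈ₛ-sym : ∀ {S S′} → S ≈ₛ S′ → S′ ≈ₛ S
≈ₛ-sym (a , s) = ↭-sym a , ↭-sym s

≈ₛ-trans : ∀ {S S′ S″} → S ≈ₛ S′ → S′ ≈ₛ S″ → S ≈ₛ S″
≈ₛ-trans (a , s) (a′ , s′) = ↭-trans a a′ , ↭-trans s s′

_≈ₛ?_ : ∀ S S′ → Dec (S ≈ₛ S′)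
S ≈ₛ? S′ = (ante S ↭? ante S′) ×-dec (succ S ↭? succ S′)

∪ₛ-comm : ∀ S S′ → (S ∪ₛ S′) ≈ₛ (S′ ∪ₛ S)
∪ₛ-comm S S′ = ++-comm (ante S) (ante S′) , ++-comm (succ S) (succ S′)

∪ₛ-,∘-swap : ∀ S xs φ → ((S ∪ₛ ⟨ xs ∣ [] ⟩) ,∘ φ) ≈ₛ (⟨ xs ∣ [ φ ] ⟩ ∪ₛ S)
∪ₛ-,∘-swap S xs φ = ++-comm (ante S) xs , ↭-prep φ (↭-reflexive (++-identityʳ (succ S)))

_⊑ₛ?_ : ∀ S S′ → Dec (S ⊑ₛ S′)
S ⊑ₛ? S′ = (ante S ⊑? ante S′) ×-dec (succ S ⊑? succ S′)

⊑ₛ-refl : ∀ {S} → S ⊑ₛ S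
⊑ₛ-refl = ⊑-refl , ⊑-refl

∅⊑ₛ : ∀ {S} → ⟨ [] ∣ [] ⟩ ⊑ₛ S
∅⊑ₛ = []⊑ , []⊑

⊑ₛ-trans : ∀ {S S′ S″} → S ⊑ₛ S′ → S′ ⊑ₛ S″ → S ⊑ₛ S″
⊑ₛ-trans (a , s) (a′ , s′) = ⊑-trans a a′ , ⊑-trans s s′

⊑ₛ-resp-≈ : ∀ {R S S′} → S ≈ₛ S′ → R ⊑ₛ S → R ⊑ₛ S′
⊑ₛ-resp-≈ (a , s) (R⊑a , R⊑s) = ⊑-trans R⊑a (↭⇒⊑ a) , ⊑-trans R⊑s (↭⇒⊑ s)

⊑ₛ-∪ʳ : ∀ R S → R ⊑ₛ R ∪ₛ S
⊑ₛ-∪ʳ R S = ⊑-++ʳ (ante R) (ante S) , ⊑-++ʳ (succ R) (succ S)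

⊑ₛ-∪ˡ : ∀ {R S} Q → R ⊑ₛ S → R ⊑ₛ Q ∪ₛ S
⊑ₛ-∪ˡ Q (a , s) = ⊑-++ˡ (ante Q) a , ⊑-++ˡ (succ Q) s

⊑ₛ-∖-cancelˡ : ∀ {R S X} Q → R ⊑ₛ Q ∪ₛ S → X ⊑ₛ R ∖ₛ Q → X ⊑ₛ S
⊑ₛ-∖-cancelˡ Q (a , s) (a′ , s′) = ⊑-∖-cancelˡ a a′ , ⊑-∖-cancelˡ s s′

-- Words and branches

infix 4 _≼_

_≼_ : List ℕ → List ℕ → Set
u ≼ w = ∃ λ v → u ++ v ≡ w

[]≼ : ∀ {w} → [] ≼ w
[]≼ {w} = w , refl

≼-refl : ∀ {w} → w ≼ w
≼-refl {w} = [] , ++-identityʳ w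

≼-trans : ∀ {u v w} → u ≼ v → v ≼ w → u ≼ w
≼-trans {u} (a , refl) (b , refl) = a ++ b , sym (++-assoc u a b)

≼-∷ʳ : ∀ w i → w ≼ w ∷ʳ i
≼-∷ʳ w i = [ i ] , refl

≼-[] : ∀ {u} → u ≼ [] → u ≡ []
≼-[] {u} (v , eq) = ++-conicalˡ u v eq

≼-∷ʳ-inv : ∀ {u} w i → u ≼ w ∷ʳ i → u ≡ w ∷ʳ i ⊎ u ≼ w
≼-∷ʳ-inv {[]}    w       i _        = inj₂ []≼
≼-∷ʳ-inv {c ∷ u} []      i (v , eq) with ∷-injective eq
... | refl , u++v≡[] with ++-conicalˡ u v u++v≡[]
...   | refl = inj₁ refl
≼-∷ʳ-inv {c ∷ u} (d ∷ w) i (v , eq) with ∷-injective eq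
... | refl , eq′ with ≼-∷ʳ-inv w i (v , eq′)
...   | inj₁ refl        = inj₁ refl
...   | inj₂ (v′ , refl) = inj₂ (v′ , refl)

≼-node : ∀ {π u w} → Node π w → u ≼ w → Node π u
≼-node {u = u} root (v , eq) rewrite ++-conicalˡ u v eq = root
≼-node (child {w} {i} n i<) u≼w∷ʳi with ≼-∷ʳ-inv w i u≼w∷ʳi
... | inj₁ refl = child n i<
... | inj₂ u≼w  = ≼-node n u≼w

length-∷ʳ : ∀ (w : List ℕ) i → length (w ∷ʳ i) ≡ suc (length w)
length-∷ʳ w i = trans (length-++ w) (+-comm (length w) 1)

length-pref : ∀ β n → length (pref β n) ≡ n
length-pref β zero    = refl
length-pref β (suc n) = trans (length-∷ʳ (pref β n) (β n)) (cong suc (length-pref β n))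

≼-pref : ∀ {u} β n → u ≼ pref β n → u ≡ pref β (length u)
≼-pref {u} β zero    (v , eq) rewrite ++-conicalˡ u v eq = refl
≼-pref     β (suc n) u≼       with ≼-∷ʳ-inv (pref β n) (β n) u≼
... | inj₁ refl = cong (pref β) (sym (length-pref β (suc n)))
... | inj₂ u≼′  = ≼-pref β n u≼′

-- 0 past the end of the list
_!_ : List ℕ → ℕ → ℕ
[]       ! _     = 0
(x ∷ xs) ! zero  = x
(x ∷ xs) ! suc n = xs ! n

++-! : ∀ xs b ys → (xs ++ b ∷ ys) ! length xs ≡ b
++-! []       b ys = refl
++-! (x ∷ xs) b ys = ++-! xs b ys

module Limit (Ω : ℕ → List ℕ) (Ω-mono : ∀ j → Ω j ≼ Ω (suc j)) (Ω-long : ∀ j → j ≤ length (Ω j)) where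

  limit : ℕ → ℕ
  limit m = Ω (suc m) ! m

  pref-limit-≼ : ∀ m → pref limit m ≼ Ω m
  pref-limit-≼ zero    = []≼
  pref-limit-≼ (suc m) with ≼-trans (pref-limit-≼ m) (Ω-mono m)
  ... | [] , eq = contradiction (≤-trans (Ω-long (suc m)) (≤-reflexive length-Ω)) (<-irrefl refl)
    where
    length-Ω : length (Ω (suc m)) ≡ m
    length-Ω = trans (cong length (trans (sym eq) (++-identityʳ (pref limit m)))) (length-pref limit m)
  ... | b ∷ v , eq = v , (begin
    pref limit m ∷ʳ limit m ++ v  ≡⟨ cong (λ c → pref limit m ∷ʳ c ++ v) limit-m ⟩
    pref limit m ∷ʳ b ++ v        ≡⟨ ∷ʳ-++ (pref limit m) b v ⟩
    pref limit m ++ b ∷ v         ≡⟨ eq ⟩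
    Ω (suc m)                     ∎)
    where
    open ≡-Reasoning
    limit-m : limit m ≡ b
    limit-m = begin
      Ω (suc m) ! m               ≡⟨ cong (_! m) (sym eq) ⟩
      Ω′ ! m                      ≡⟨ cong (Ω′ !_) (length-pref limit m) ⟨
      Ω′ ! length (pref limit m)  ≡⟨ ++-! (pref limit m) b v ⟩
      b                           ∎
      where
      Ω′ : List ℕ
      Ω′ = pref limit m ++ b ∷ v

-- Rule instances

isBoxRight : Rule → ℕ → Bool
isBoxRight Box 1 = true
isBoxRight _   _ = false

rightBoxPrem-∷ʳ : ∀ {P} w i → RightBoxPrem P (w ∷ʳ i) → rule P w ≡ Box × i ≡ 1
rightBoxPrem-∷ʳ w i (u , eq , box) with ∷ʳ-injective w u eq
... | refl , refl = box , refl

¬rightBoxPrem-∷ʳ : ∀ P w i → isBoxRight (rule P w) i ≡ false → ¬ RightBoxPrem P (w ∷ʳ i)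
¬rightBoxPrem-∷ʳ P w i notBoxRight rbp with rightBoxPrem-∷ʳ {P} w i rbp
... | box , refl rewrite box = contradiction notBoxRight λ ()

¬rightBoxPrem-[] : ∀ P → ¬ RightBoxPrem P []
¬rightBoxPrem-[] P (u , eq , _) = contradiction (++-conicalʳ u [ 1 ] (sym eq)) λ ()

RuleInstance : Rule → Sequent → (ℕ → Sequent) → Set
RuleInstance Ax   C P = Σ Sequent λ S → Σ ℕ λ p → C ≈ₛ (S ,• var p ,∘ var p)
RuleInstance ⊥•   C P = Σ Sequent λ S → C ≈ₛ (S ,• ⊥')
RuleInstance →•   C P = Σ Sequent λ S → Σ Fm λ φ → Σ Fm λ ψ →
  C ≈ₛ (S ,• (φ ⇒ ψ)) × P 0 ≈ₛ (S ,∘ φ) × P 1 ≈ₛ (S ,• ψ)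
RuleInstance →∘   C P = Σ Sequent λ S → Σ Fm λ φ → Σ Fm λ ψ →
  C ≈ₛ (S ,∘ (φ ⇒ ψ)) × P 0 ≈ₛ (S ,• φ ,∘ ψ)
RuleInstance Refl C P = Σ Sequent λ S → Σ Fm λ φ →
  C ≈ₛ (S ,• □ φ) × P 0 ≈ₛ (S ,• φ ,• □ φ)
RuleInstance Box  C P = Σ Sequent λ S → Σ (List Fm) λ Π → Σ Fm λ φ →
  C ≈ₛ ((S ∪ₛ ⟨ □* Π ∣ [] ⟩) ,∘ □ φ) × P 0 ≈ₛ ((S ∪ₛ ⟨ □* Π ∣ [] ⟩) ,∘ φ)
    × P 1 ≈ₛ (⟨ □* Π ∣ [] ⟩ ,∘ φ)
RuleInstance Cut  C P = Σ Sequent λ S → Σ Fm λ φ →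
  C ≈ₛ S × P 0 ≈ₛ (S ,∘ φ) × P 1 ≈ₛ (S ,• φ)

Instance≡RuleInstance : ∀ P w → Instance P w ≡ RuleInstance (rule P w) (seq P w) (λ i → seq P (w ∷ʳ i))
Instance≡RuleInstance P w with rule P w
... | Ax   = refl
... | ⊥•   = refl
... | →•   = refl
... | →∘   = refl
... | Refl = refl
... | Box  = refl
... | Cut  = refl

RuleInstance-resp : ∀ r {C C′ P P′} → C′ ≈ₛ C → (∀ i → P′ i ≈ₛ P i)
  → RuleInstance r C P → RuleInstance r C′ P′
RuleInstance-resp Ax   c p (S , q , e)               = S , q , ≈ₛ-trans c e
RuleInstance-resp ⊥•   c p (S , e)                   = S , ≈ₛ-trans c e
RuleInstance-resp →•   c p (S , φ , ψ , e , e₀ , e₁) =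
  S , φ , ψ , ≈ₛ-trans c e , ≈ₛ-trans (p 0) e₀ , ≈ₛ-trans (p 1) e₁
RuleInstance-resp →∘   c p (S , φ , ψ , e , e₀)      = S , φ , ψ , ≈ₛ-trans c e , ≈ₛ-trans (p 0) e₀
RuleInstance-resp Refl c p (S , φ , e , e₀)          = S , φ , ≈ₛ-trans c e , ≈ₛ-trans (p 0) e₀
RuleInstance-resp Box  c p (S , Π , φ , e , e₀ , e₁) =
  S , Π , φ , ≈ₛ-trans c e , ≈ₛ-trans (p 0) e₀ , ≈ₛ-trans (p 1) e₁
RuleInstance-resp Cut  c p (S , φ , e , e₀ , e₁)     =
  S , φ , ≈ₛ-trans c e , ≈ₛ-trans (p 0) e₀ , ≈ₛ-trans (p 1) e₁

Reusable : (Sequent → Sequent) → Rule → Sequent → (ℕ → Sequent) → ℕ → Set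
Reusable T r C P i = i < arity r × isBoxRight r i ≡ false × P i ≈ₛ T C

reusable? : ∀ T r C P → Dec (∃ (Reusable T r C P))
reusable? T r C P = anyUpTo? (λ i → (isBoxRight r i Bool.≟ false) ×-dec (P i ≈ₛ? T C)) (arity r)

LocallySound : (Sequent → Sequent) → (Sequent → Set) → Set
LocallySound T I = ∀ r C P → I C → RuleInstance r C P → (∀ i → ¬ Reusable T r C P i)
  → RuleInstance r (T C) (λ i → if isBoxRight r i then P i else T (P i))
  × (∀ i → i < arity r → isBoxRight r i ≡ false → I (P i))

-- Transforming a proof node by node

module Transformation
  (T : Sequent → Sequent) (I : Sequent → Set) (I? : ∀ C → Dec (I C))
  (T-resp : ∀ {C C′} → C ≈ₛ C′ → T C ≈ₛ T C′) (I-resp : ∀ {C C′} → C ≈ₛ C′ → I C → I C′)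
  (sound : LocallySound T I)
  where

  record Position : Set where
    constructor ⟪_,_⟫
    field
      origin : List ℕ
      active : Bool
  open Position

  module Along (π : Proof) (I-root : I (seq (tree π) [])) where

    σ : List ℕ → Sequent
    σ = seq (tree π)

    ρ : List ℕ → Rule
    ρ = rule (tree π)

    premisesAt : List ℕ → ℕ → Sequent
    premisesAt o i = σ (o ∷ʳ i)

    ReusableAt : List ℕ → ℕ → Set
    ReusableAt o = Reusable T (ρ o) (σ o) (premisesAt o)

    settle : List ℕ → Position
    settle o with reusable? T (ρ o) (σ o) (premisesAt o)
    ... | yes (j , _) = ⟪ o ∷ʳ j , false ⟫
    ... | no _        = ⟪ o , true ⟫

    step : Position → ℕ → Position
    step ⟪ o , false ⟫ i = ⟪ o ∷ʳ i , false ⟫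
    step ⟪ o , true  ⟫ i = if isBoxRight (ρ o) i then ⟪ o ∷ʳ i , false ⟫ else settle (o ∷ʳ i)

    position : List ℕ → Position
    position = foldl step (settle [])

    position-∷ʳ : ∀ w i → position (w ∷ʳ i) ≡ step (position w) i
    position-∷ʳ w i = foldl-∷ʳ step (settle []) i w

    sequentAt : Position → Sequent
    sequentAt ⟪ o , t ⟫ = if t then T (σ o) else σ o

    tree′ : Preproof
    tree′ = record { seq = sequentAt ∘ position ; rule = ρ ∘ origin ∘ position }

    data Settles (o : List ℕ) : Position → Set where
      stay  : (∀ j → ¬ ReusableAt o j) → Settles o ⟪ o , true ⟫
      reuse : ∀ {j} → ReusableAt o j → Settles o ⟪ o ∷ʳ j , false ⟫

    settles : ∀ o → Settles o (settle o)
    settles o with reusable? T (ρ o) (σ o) (premisesAt o)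
    ... | yes (j , reusable) = reuse reusable
    ... | no ¬reusable       = stay λ j reusable → ¬reusable (j , reusable)

    data Steps : Position → ℕ → Position → Set where
      copy  : ∀ {o i} → Steps ⟪ o , false ⟫ i ⟪ o ∷ʳ i , false ⟫
      leave : ∀ {o i} → isBoxRight (ρ o) i ≡ true → Steps ⟪ o , true ⟫ i ⟪ o ∷ʳ i , false ⟫
      enter : ∀ {o i p} → isBoxRight (ρ o) i ≡ false → Settles (o ∷ʳ i) p → Steps ⟪ o , true ⟫ i p

    steps : ∀ p i → Steps p i (step p i)
    steps ⟪ o , false ⟫ i = copy
    steps ⟪ o , true  ⟫ i with isBoxRight (ρ o) i in eq
    ... | true  = leave eq
    ... | false = enter eq (settles (o ∷ʳ i))

    steps-≼ : ∀ {p i q} → Steps p i q → origin p ≼ origin q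
    steps-≼ {⟪ o , _ ⟫} {i} copy                    = ≼-∷ʳ o i
    steps-≼ {⟪ o , _ ⟫} {i} (leave _)               = ≼-∷ʳ o i
    steps-≼ {⟪ o , _ ⟫} {i} (enter _ (stay _))      = ≼-∷ʳ o i
    steps-≼ {⟪ o , _ ⟫} {i} (enter _ (reuse {j} _)) = ≼-trans (≼-∷ʳ o i) (≼-∷ʳ (o ∷ʳ i) j)

    ruleInstanceAt : ∀ {o} → Node (tree π) o → RuleInstance (ρ o) (σ o) (premisesAt o)
    ruleInstanceAt {o} n = subst id (Instance≡RuleInstance (tree π) o) (locallyOK π o n)

    Valid : Position → Set
    Valid ⟪ o , false ⟫ = Node (tree π) o
    Valid ⟪ o , true  ⟫ = Node (tree π) o × I (σ o) × (∀ j → ¬ ReusableAt o j)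

    valid-node : ∀ {p} → Valid p → Node (tree π) (origin p)
    valid-node {⟪ _ , false ⟫} n       = n
    valid-node {⟪ _ , true  ⟫} (n , _) = n

    settles-valid : ∀ {o p} → Node (tree π) o → I (σ o) → Settles o p → Valid p
    settles-valid n Io (stay fresh)     = n , Io , fresh
    settles-valid n Io (reuse (j< , _)) = child n j<

    steps-valid : ∀ {p i q} → Valid p → i < arity (ρ (origin p)) → Steps p i q → Valid q
    steps-valid n       i< copy      = child n i<
    steps-valid (n , _) i< (leave _) = child n i<
    steps-valid {⟪ o , true ⟫} {i} (n , Io , fresh) i< (enter notBoxRight s) =
      settles-valid (child n i<) (premise-I i i< notBoxRight) s
      where
      premise-I : ∀ i → i < arity (ρ o) → isBoxRight (ρ o) i ≡ false → I (premisesAt o i)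
      premise-I = proj₂ (sound (ρ o) (σ o) (premisesAt o) Io (ruleInstanceAt n) fresh)

    valid : ∀ {w} → Node tree′ w → Valid (position w)
    valid root                 = settles-valid root I-root (settles [])
    valid (child {w} {i} n i<) =
      subst Valid (sym (position-∷ʳ w i)) (steps-valid (valid n) i< (steps (position w) i))

    -- A reuse skips one inference, and happens at most once on a path: afterwards nothing is
    -- transformed any more.
    Depth : ℕ → Position → Set
    Depth n ⟪ o , true  ⟫ = length o ≡ n
    Depth n ⟪ o , false ⟫ = n ≤ length o × length o ≤ suc n

    depth-≤ : ∀ {n} p → Depth n p → n ≤ length (origin p)
    depth-≤ ⟪ _ , true  ⟫ o≡n       = ≤-reflexive (sym o≡n)
    depth-≤ ⟪ _ , false ⟫ (n≤o , _) = n≤o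

    depth-≥ : ∀ {n} p → Depth n p → length (origin p) ≤ suc n
    depth-≥ ⟪ _ , true  ⟫ o≡n       = m≤n⇒m≤1+n (≤-reflexive o≡n)
    depth-≥ ⟪ _ , false ⟫ (_ , o≤n) = o≤n

    settles-depth : ∀ {o n p} → length o ≡ n → Settles o p → Depth n p
    settles-depth o≡n (stay _) = o≡n
    settles-depth {o} {n} o≡n (reuse {j} _) =
      subst (λ m → n ≤ m × m ≤ suc n) (sym (length-∷ʳ o j))
        (m≤n⇒m≤1+n (≤-reflexive (sym o≡n)) , s≤s (≤-reflexive o≡n))

    steps-depth : ∀ {n p i q} → Depth n p → Steps p i q → Depth (suc n) q
    steps-depth {n} {⟪ o , _ ⟫} {i} (n≤o , o≤n) copy =
      subst (λ m → suc n ≤ m × m ≤ suc (suc n)) (sym (length-∷ʳ o i)) (s≤s n≤o , s≤s o≤n)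
    steps-depth {n} {⟪ o , _ ⟫} {i} o≡n (leave _) =
      subst (λ m → suc n ≤ m × m ≤ suc (suc n)) (sym (length-∷ʳ o i))
        (s≤s (≤-reflexive (sym o≡n)) , s≤s (m≤n⇒m≤1+n (≤-reflexive o≡n)))
    steps-depth {n} {⟪ o , _ ⟫} {i} o≡n (enter _ s) = settles-depth (trans (length-∷ʳ o i) (cong suc o≡n)) s

    depth : ∀ {w} → Node tree′ w → Depth (length w) (position w)
    depth root                 = settles-depth refl (settles [])
    depth (child {w} {i} n i<) =
      subst₂ Depth (sym (length-∷ʳ w i)) (sym (position-∷ʳ w i)) (steps-depth (depth n) (steps (position w) i))

    Reflected : List ℕ → List ℕ → Set
    Reflected w x = ∃ λ u → u ≼ w × RightBoxPrem tree′ u × length x ≤ suc (length u)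

    reflect-∷ʳ : ∀ {w o x} i → rule tree′ w ≡ ρ o → length o ≤ suc (length w)
      → (x ≼ o → Reflected w x) → RightBoxPrem (tree π) x → x ≼ o ∷ʳ i → Reflected (w ∷ʳ i) x
    reflect-∷ʳ {w} {o} i same-rule o≤w below rbp x≼o∷ʳi with ≼-∷ʳ-inv o i x≼o∷ʳi
    ... | inj₁ refl with rightBoxPrem-∷ʳ {tree π} o i rbp
    ...   | box , refl = w ∷ʳ 1 , ≼-refl , (w , refl , trans same-rule box) ,
      subst₂ _≤_ (sym (length-∷ʳ o 1)) (cong suc (sym (length-∷ʳ w 1))) (s≤s o≤w)
    reflect-∷ʳ {w} i _ _ below _ _ | inj₂ x≼o with below x≼o
    ... | u , u≼w , rbp′ , x≤u = u , ≼-trans u≼w (≼-∷ʳ w i) , rbp′ , x≤u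

    reflect-steps : ∀ {w p i q x} → rule tree′ w ≡ ρ (origin p) → length (origin p) ≤ suc (length w)
      → (x ≼ origin p → Reflected w x) → RightBoxPrem (tree π) x → Steps p i q → x ≼ origin q
      → Reflected (w ∷ʳ i) x
    reflect-steps {i = i} same-rule o≤w below rbp copy               = reflect-∷ʳ i same-rule o≤w below rbp
    reflect-steps {i = i} same-rule o≤w below rbp (leave _)          = reflect-∷ʳ i same-rule o≤w below rbp
    reflect-steps {i = i} same-rule o≤w below rbp (enter _ (stay _)) = reflect-∷ʳ i same-rule o≤w below rbp
    reflect-steps {p = ⟪ o , _ ⟫} {i} same-rule o≤w below rbp (enter _ (reuse {j} (_ , notBoxRight , _))) x≼
      with ≼-∷ʳ-inv (o ∷ʳ i) j x≼
    ... | inj₁ refl   = contradiction rbp (¬rightBoxPrem-∷ʳ (tree π) (o ∷ʳ i) j notBoxRight)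
    ... | inj₂ x≼o∷ʳi = reflect-∷ʳ i same-rule o≤w below rbp x≼o∷ʳi

    reflect : ∀ {w x} → Node tree′ w → x ≼ origin (position w) → RightBoxPrem (tree π) x → Reflected w x
    reflect root x≼ rbp with settle [] | settles []
    ... | _ | stay _ = contradiction (subst (RightBoxPrem (tree π)) (≼-[] x≼) rbp) (¬rightBoxPrem-[] (tree π))
    ... | _ | reuse {j} (_ , notBoxRight , _) with ≼-∷ʳ-inv [] j x≼
    ...   | inj₁ refl = contradiction rbp (¬rightBoxPrem-∷ʳ (tree π) [] j notBoxRight)
    ...   | inj₂ x≼[] = contradiction (subst (RightBoxPrem (tree π)) (≼-[] x≼[]) rbp) (¬rightBoxPrem-[] (tree π))
    reflect (child {w} {i} n i<) x≼ rbp =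
      reflect-steps refl (depth-≥ (position w) (depth n)) (λ x≼o → reflect n x≼o rbp) rbp (steps (position w) i)
        (subst (λ p → _ ≼ origin p) (position-∷ʳ w i) x≼)

    settle-sequent : ∀ o → sequentAt (settle o) ≈ₛ T (σ o)
    settle-sequent o with settle o | settles o
    ... | _ | stay _                   = ≈ₛ-refl
    ... | _ | reuse (_ , _ , reusable) = reusable

    step-sequent : ∀ o i
      → sequentAt (step ⟪ o , true ⟫ i) ≈ₛ (if isBoxRight (ρ o) i then σ (o ∷ʳ i) else T (σ (o ∷ʳ i)))
    step-sequent o i with isBoxRight (ρ o) i
    ... | true  = ≈ₛ-refl
    ... | false = settle-sequent (o ∷ʳ i)

    valid-ruleInstance : ∀ p → Valid p → RuleInstance (ρ (origin p)) (sequentAt p) (sequentAt ∘ step p)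
    valid-ruleInstance ⟪ o , false ⟫ n                = ruleInstanceAt n
    valid-ruleInstance ⟪ o , true  ⟫ (n , Io , fresh) =
      RuleInstance-resp (ρ o) ≈ₛ-refl (step-sequent o)
        (proj₁ (sound (ρ o) (σ o) (premisesAt o) Io (ruleInstanceAt n) fresh))

    locallyOK′ : ∀ w → Node tree′ w → Instance tree′ w
    locallyOK′ w n = subst id (sym (Instance≡RuleInstance tree′ w))
      (RuleInstance-resp (ρ (origin (position w))) ≈ₛ-refl (λ i → ≈ₛ-reflexive (cong sequentAt (position-∷ʳ w i)))
        (valid-ruleInstance (position w) (valid n)))

    module Fairness (β : ℕ → ℕ) (branch : IsBranch tree′ β) where

      Ω : ℕ → List ℕ
      Ω j = origin (position (pref β j))

      Ω-mono : ∀ j → Ω j ≼ Ω (suc j)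
      Ω-mono j = subst (λ p → Ω j ≼ origin p) (sym (position-∷ʳ (pref β j) (β j)))
        (steps-≼ (steps (position (pref β j)) (β j)))

      Ω-long : ∀ j → j ≤ length (Ω j)
      Ω-long j = subst (_≤ length (Ω j)) (length-pref β j) (depth-≤ (position (pref β j)) (depth (branch j)))

      open Limit Ω Ω-mono Ω-long

      limit-branch : IsBranch (tree π) limit
      limit-branch m = ≼-node (valid-node (valid (branch m))) (pref-limit-≼ m)

      fair′ : Fair tree′ β
      fair′ n with fair π limit limit-branch (suc n)
      ... | m , n<m , rbp with reflect (branch m) (pref-limit-≼ m) rbp
      ...   | u , u≼ , rbp′ , m≤u =
        length u , ≤-pred (≤-trans n<m (subst (_≤ suc (length u)) (length-pref limit m) m≤u)) ,
        subst (RightBoxPrem tree′) (≼-pref β m u≼) rbp′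

    transformed : Proof
    transformed = record { tree = tree′ ; locallyOK = locallyOK′ ; fair = Fairness.fair′ }

    transformed-root : transformed ⊢ T (σ [])
    transformed-root = settle-sequent []

    mainInner : ∀ {w} → MainInner transformed w → MainInner π (origin (position w))
    mainInner (n , outside) = valid-node (valid n) , λ x v eq rbp →
      let u , (v′ , eq′) , rbp′ , _ = reflect n (v , eq) rbp in outside u v′ eq′ rbp′

    transformed-height : ∀ k → LocalHeight≤ π k → LocalHeight≤ transformed k
    transformed-height k height w (inj₁ inner) =
      ≤-trans (depth-≤ (position w) (depth (proj₁ inner))) (height _ (inj₁ (mainInner inner)))
    transformed-height k height _ (inj₂ (u , refl , inner , box)) = begin
      length (u ∷ʳ 1)                    ≡⟨ length-∷ʳ u 1 ⟩
      suc (length u)                     ≤⟨ s≤s (depth-≤ (position u) (depth (proj₁ inner))) ⟩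
      suc (length (origin (position u))) ≡⟨ length-∷ʳ (origin (position u)) 1 ⟨
      length (origin (position u) ∷ʳ 1)  ≤⟨ height _ (inj₂ (_ , refl , mainInner inner , box)) ⟩
      k                                  ∎
      where open ≤-Reasoning

    transformed-cutFree : MainCutFree π → MainCutFree transformed
    transformed-cutFree cutFree w inner = cutFree _ (mainInner inner)

  transform : Proof → Proof
  transform π with I? (seq (tree π) [])
  ... | yes I-root = Along.transformed π I-root
  ... | no _       = π

  transform-⊢ : ∀ π C → π ⊢ C → I C → transform π ⊢ T C
  transform-⊢ π C π⊢C IC with I? (seq (tree π) [])
  ... | yes I-root = ≈ₛ-trans (Along.transformed-root π I-root) (T-resp π⊢C)
  ... | no ¬I-root = contradiction (I-resp (≈ₛ-sym π⊢C) IC) ¬I-root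

  transform-preserves : Preserves transform
  transform-preserves = height , cutFree
    where
    height : PreservesLocalHeight transform
    height π k with I? (seq (tree π) [])
    ... | yes I-root = Along.transformed-height π I-root k
    ... | no _       = id
    cutFree : PreservesMainCutFree transform
    cutFree π with I? (seq (tree π) [])
    ... | yes I-root = Along.transformed-cutFree π I-root
    ... | no _       = id

-- Deleting and adding formulas

-- Contraction is the one case with R ≠ D: both copies of p are required, so that an axiom
-- on p still has a p once one copy is deleted.
module DeleteAdd (D R A : Sequent) (D⊑R : D ⊑ₛ R) where

  T : Sequent → Sequent
  T C = A ∪ₛ (C ∖ₛ D)

  I : Sequent → Set
  I C = R ⊑ₛ C

  T-resp : ∀ {C C′} → C ≈ₛ C′ → T C ≈ₛ T C′
  T-resp (a , s) = ++⁺ˡ (ante A) (∖-resp-↭ (ante D) a) , ++⁺ˡ (succ A) (∖-resp-↭ (succ D) s)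

  T-cancel : ∀ S → T (D ∪ₛ S) ≈ₛ (A ∪ₛ S)
  T-cancel S = ++⁺ˡ (ante A) (++-∖-cancelˡ (ante D) (ante S)) , ++⁺ˡ (succ A) (++-∖-cancelˡ (succ D) (succ S))

  T-split : ∀ Q {C S} → C ≈ₛ (Q ∪ₛ S) → D ⊑ₛ S → T C ≈ₛ (Q ∪ₛ T S)
  T-split Q C≈Q∪S (a , s) = ≈ₛ-trans (T-resp C≈Q∪S) (shift (ante A) (ante Q) a , shift (succ A) (succ Q) s)
    where
    shift : ∀ as qs {ds ss} → ds ⊑ ss → as ++ (qs ++ ss) ∖ ds ↭ qs ++ as ++ ss ∖ ds
    shift as qs ds⊑ss = ↭-trans (++⁺ˡ as (++-∖-assoc qs ds⊑ss)) (shifts as qs)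

  -- The principal formulas Q of each rule must leave R (at an axiom: D) in the context; an
  -- inference whose premise is reused instead is exempt.
  record Admissible : Set where
    field
      on-Ax   : ∀ p → D ⊑ₛ R ∖ₛ ⟨ [ var p ] ∣ [ var p ] ⟩
      on-⊥•   : D ⊑ₛ R ∖ₛ ⟨ [ ⊥' ] ∣ [] ⟩
      on-→•   : ∀ S φ ψ → ¬ (S ,∘ φ) ≈ₛ T (S ,• (φ ⇒ ψ)) → ¬ (S ,• ψ) ≈ₛ T (S ,• (φ ⇒ ψ))
                → R ⊑ₛ R ∖ₛ ⟨ [ φ ⇒ ψ ] ∣ [] ⟩
      on-→∘   : ∀ S φ ψ → ¬ (S ,• φ ,∘ ψ) ≈ₛ T (S ,∘ (φ ⇒ ψ))
                → R ⊑ₛ R ∖ₛ ⟨ [] ∣ [ φ ⇒ ψ ] ⟩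
      on-Refl : ∀ φ → R ⊑ₛ R ∖ₛ ⟨ [ □ φ ] ∣ [] ⟩
      on-Box  : ∀ S Π φ → let S□ = S ∪ₛ ⟨ □* Π ∣ [] ⟩ in ¬ (S□ ,∘ φ) ≈ₛ T (S□ ,∘ □ φ)
                → R ⊑ₛ R ∖ₛ ⟨ □* Π ∣ [ □ φ ] ⟩

  module InContext {S} (R⊑S : R ⊑ₛ S) where

    shift : ∀ Q {X} → X ≈ₛ (Q ∪ₛ S) → T X ≈ₛ (Q ∪ₛ T S)
    shift Q X≈ = T-split Q X≈ (⊑ₛ-trans D⊑R R⊑S)

    holds : ∀ Q {X} → X ≈ₛ (Q ∪ₛ S) → I X
    holds Q X≈ = ⊑ₛ-resp-≈ (≈ₛ-sym X≈) (⊑ₛ-∪ˡ Q R⊑S)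

  module Sound (admissible : Admissible) where
    open Admissible admissible

    not-reused : ∀ r {C P C′ P′} i → (∀ j → ¬ Reusable T r C P j) → i < arity r → isBoxRight r i ≡ false
      → C ≈ₛ C′ → P i ≈ₛ P′ → ¬ P′ ≈ₛ T C′
    not-reused _ i fresh i< notBoxRight C≈C′ Pi≈P′ P′≈TC′ =
      fresh i (i< , notBoxRight , ≈ₛ-trans Pi≈P′ (≈ₛ-trans P′≈TC′ (T-resp (≈ₛ-sym C≈C′))))

    sound : LocallySound T I
    sound Ax C P R⊑C (S , p , C≈) _ =
      (T S , p , T-split Q C≈ (⊑ₛ-∖-cancelˡ Q (⊑ₛ-resp-≈ C≈ R⊑C) (on-Ax p))) , λ _ ()
      where
      Q : Sequent
      Q = ⟨ [ var p ] ∣ [ var p ] ⟩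
    sound ⊥• C P R⊑C (S , C≈) _ =
      (T S , T-split Q C≈ (⊑ₛ-∖-cancelˡ Q (⊑ₛ-resp-≈ C≈ R⊑C) on-⊥•)) , λ _ ()
      where
      Q : Sequent
      Q = ⟨ [ ⊥' ] ∣ [] ⟩
    sound →• C P R⊑C (S , φ , ψ , C≈ , P₀≈ , P₁≈) fresh =
      (T S , φ , ψ , shift Q C≈ , shift ⟨ [] ∣ [ φ ] ⟩ P₀≈ , shift ⟨ [ ψ ] ∣ [] ⟩ P₁≈) , premises
      where
      Q : Sequent
      Q = ⟨ [ φ ⇒ ψ ] ∣ [] ⟩
      open InContext (⊑ₛ-∖-cancelˡ Q (⊑ₛ-resp-≈ C≈ R⊑C) (on-→• S φ ψ
        (not-reused →• 0 fresh (s≤s z≤n) refl C≈ P₀≈) (not-reused →• 1 fresh (s≤s (s≤s z≤n)) refl C≈ P₁≈)))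
      premises : ∀ i → i < 2 → isBoxRight →• i ≡ false → I (P i)
      premises 0             _              _ = holds ⟨ [] ∣ [ φ ] ⟩ P₀≈
      premises 1             _              _ = holds ⟨ [ ψ ] ∣ [] ⟩ P₁≈
      premises (suc (suc _)) (s≤s (s≤s ())) _
    sound →∘ C P R⊑C (S , φ , ψ , C≈ , P₀≈) fresh =
      (T S , φ , ψ , shift Q C≈ , shift ⟨ [ φ ] ∣ [ ψ ] ⟩ P₀≈) , premises
      where
      Q : Sequent
      Q = ⟨ [] ∣ [ φ ⇒ ψ ] ⟩
      open InContext (⊑ₛ-∖-cancelˡ Q (⊑ₛ-resp-≈ C≈ R⊑C)
        (on-→∘ S φ ψ (not-reused →∘ 0 fresh (s≤s z≤n) refl C≈ P₀≈)))
      premises : ∀ i → i < 1 → isBoxRight →∘ i ≡ false → I (P i)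
      premises 0       _        _ = holds ⟨ [ φ ] ∣ [ ψ ] ⟩ P₀≈
      premises (suc _) (s≤s ()) _
    sound Refl C P R⊑C (S , φ , C≈ , P₀≈) _ =
      (T S , φ , shift Q C≈ , shift ⟨ □ φ ∷ [ φ ] ∣ [] ⟩ P₀≈) , premises
      where
      Q : Sequent
      Q = ⟨ [ □ φ ] ∣ [] ⟩
      open InContext (⊑ₛ-∖-cancelˡ Q (⊑ₛ-resp-≈ C≈ R⊑C) (on-Refl φ))
      premises : ∀ i → i < 1 → isBoxRight Refl i ≡ false → I (P i)
      premises 0       _        _ = holds ⟨ □ φ ∷ [ φ ] ∣ [] ⟩ P₀≈
      premises (suc _) (s≤s ()) _
    sound Box C P R⊑C (S , Π , φ , C≈ , P₀≈ , P₁≈) fresh =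
      (T S , Π , φ , boxed (□ φ) C≈ , boxed φ P₀≈ , P₁≈) , premises
      where
      Q : Sequent
      Q = ⟨ □* Π ∣ [ □ φ ] ⟩
      open InContext (⊑ₛ-∖-cancelˡ Q (⊑ₛ-resp-≈ (≈ₛ-trans C≈ (∪ₛ-,∘-swap S (□* Π) (□ φ))) R⊑C)
        (on-Box S Π φ (not-reused Box 0 fresh (s≤s z≤n) refl C≈ P₀≈)))
      boxed : ∀ χ {X} → X ≈ₛ ((S ∪ₛ ⟨ □* Π ∣ [] ⟩) ,∘ χ)
        → T X ≈ₛ ((T S ∪ₛ ⟨ □* Π ∣ [] ⟩) ,∘ χ)
      boxed χ X≈ = ≈ₛ-trans (shift ⟨ □* Π ∣ [ χ ] ⟩ (≈ₛ-trans X≈ (∪ₛ-,∘-swap S (□* Π) χ)))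
                            (≈ₛ-sym (∪ₛ-,∘-swap (T S) (□* Π) χ))
      premises : ∀ i → i < 2 → isBoxRight Box i ≡ false → I (P i)
      premises 0             _              _  = holds ⟨ □* Π ∣ [ φ ] ⟩ (≈ₛ-trans P₀≈ (∪ₛ-,∘-swap S (□* Π) φ))
      premises 1             _              ()
      premises (suc (suc _)) (s≤s (s≤s ())) _
    sound Cut C P R⊑C (S , φ , C≈ , P₀≈ , P₁≈) _ =
      (T S , φ , T-resp C≈ , shift ⟨ [] ∣ [ φ ] ⟩ P₀≈ , shift ⟨ [ φ ] ∣ [] ⟩ P₁≈) , premises
      where
      open InContext (⊑ₛ-resp-≈ C≈ R⊑C)
      premises : ∀ i → i < 2 → isBoxRight Cut i ≡ false → I (P i)
      premises 0             _              _ = holds ⟨ [] ∣ [ φ ] ⟩ P₀≈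
      premises 1             _              _ = holds ⟨ [ φ ] ∣ [] ⟩ P₁≈
      premises (suc (suc _)) (s≤s (s≤s ())) _

    open Transformation T I (R ⊑ₛ?_) T-resp ⊑ₛ-resp-≈ sound public

    transform-∪ : ∀ π S → π ⊢ (D ∪ₛ S) → R ⊑ₛ D ∪ₛ S → transform π ⊢ (A ∪ₛ S)
    transform-∪ π S π⊢ R⊑ = ≈ₛ-trans (transform-⊢ π (D ∪ₛ S) π⊢ R⊑) (T-cancel S)

-- The eight transformations

-- Most obligations below hold by computation: del φ (ψ ∷ ψs) reduces to ψ ∷ del φ ψs as
-- soon as φ and ψ have different main connectives.

module Weakening (S′ : Sequent) where
  open DeleteAdd ⟨ [] ∣ [] ⟩ ⟨ [] ∣ [] ⟩ S′ ⊑ₛ-refl public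

  admissible : Admissible
  admissible = record
    { on-Ax   = λ _ → ∅⊑ₛ
    ; on-⊥•   = ∅⊑ₛ
    ; on-→•   = λ _ _ _ _ _ → ∅⊑ₛ
    ; on-→∘   = λ _ _ _ _ → ∅⊑ₛ
    ; on-Refl = λ _ → ∅⊑ₛ
    ; on-Box  = λ _ _ _ _ → ∅⊑ₛ
    }

  open Sound admissible public

module Contraction• (p : ℕ) where
  open DeleteAdd ⟨ [ var p ] ∣ [] ⟩ ⟨ var p ∷ [ var p ] ∣ [] ⟩ ⟨ [] ∣ [] ⟩
    (⊑-++ʳ [ var p ] [ var p ] , []⊑) public

  admissible : Admissible
  admissible = record
    { on-Ax   = λ q → ⊑-del-pair (var p) (var q) , []⊑
    ; on-⊥•   = ⊑-++ʳ [ var p ] [ var p ] , []⊑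
    ; on-→•   = λ _ _ _ _ _ → ⊑ₛ-refl
    ; on-→∘   = λ _ _ _ _ → ⊑ₛ-refl
    ; on-Refl = λ _ → ⊑ₛ-refl
    ; on-Box  = λ _ Π _ _ → BoxFree⇒⊑∖□* Π (λ _ → refl) , ⊑-refl
    }

  open Sound admissible public

module Contraction∘ (p : ℕ) where
  open DeleteAdd ⟨ [] ∣ [ var p ] ⟩ ⟨ [] ∣ var p ∷ [ var p ] ⟩ ⟨ [] ∣ [] ⟩
    ([]⊑ , ⊑-++ʳ [ var p ] [ var p ]) public

  admissible : Admissible
  admissible = record
    { on-Ax   = λ q → []⊑ , ⊑-del-pair (var p) (var q)
    ; on-⊥•   = []⊑ , ⊑-++ʳ [ var p ] [ var p ]
    ; on-→•   = λ _ _ _ _ _ → ⊑ₛ-refl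
    ; on-→∘   = λ _ _ _ _ → ⊑ₛ-refl
    ; on-Refl = λ _ → ⊑ₛ-refl
    ; on-Box  = λ _ _ _ _ → []⊑ , ⊑-refl
    }

  open Sound admissible public

module Inversion⊥∘ where
  open DeleteAdd ⟨ [] ∣ [ ⊥' ] ⟩ ⟨ [] ∣ [ ⊥' ] ⟩ ⟨ [] ∣ [] ⟩ ⊑ₛ-refl public

  admissible : Admissible
  admissible = record
    { on-Ax   = λ _ → ⊑ₛ-refl
    ; on-⊥•   = ⊑ₛ-refl
    ; on-→•   = λ _ _ _ _ _ → ⊑ₛ-refl
    ; on-→∘   = λ _ _ _ _ → ⊑ₛ-refl
    ; on-Refl = λ _ → ⊑ₛ-refl
    ; on-Box  = λ _ _ _ _ → []⊑ , ⊑-refl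
    }

  open Sound admissible public

module LeftInversion→• (φ ψ : Fm) where
  open DeleteAdd ⟨ [ φ ⇒ ψ ] ∣ [] ⟩ ⟨ [ φ ⇒ ψ ] ∣ [] ⟩ ⟨ [] ∣ [ φ ] ⟩ ⊑ₛ-refl public

  on-→• : ∀ S φ′ ψ′ → ¬ (S ,∘ φ′) ≈ₛ T (S ,• (φ′ ⇒ ψ′)) → ¬ (S ,• ψ′) ≈ₛ T (S ,• (φ′ ⇒ ψ′))
    → ⟨ [ φ ⇒ ψ ] ∣ [] ⟩ ⊑ₛ ⟨ [ φ ⇒ ψ ] ∣ [] ⟩ ∖ₛ ⟨ [ φ′ ⇒ ψ′ ] ∣ [] ⟩
  on-→• S φ′ ψ′ fresh _ with (φ′ ⇒ ψ′) ≟ (φ ⇒ ψ)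
  ... | yes refl = contradiction (≈ₛ-sym (T-cancel S)) fresh
  ... | no other = ⊑-del-≢ other , []⊑

  admissible : Admissible
  admissible = record
    { on-Ax   = λ _ → ⊑ₛ-refl
    ; on-⊥•   = ⊑ₛ-refl
    ; on-→•   = on-→•
    ; on-→∘   = λ _ _ _ _ → ⊑ₛ-refl
    ; on-Refl = λ _ → ⊑ₛ-refl
    ; on-Box  = λ _ Π _ _ → BoxFree⇒⊑∖□* Π (λ _ → refl) , ⊑-refl
    }

  open Sound admissible public

module RightInversion→• (φ ψ : Fm) where
  open DeleteAdd ⟨ [ φ ⇒ ψ ] ∣ [] ⟩ ⟨ [ φ ⇒ ψ ] ∣ [] ⟩ ⟨ [ ψ ] ∣ [] ⟩ ⊑ₛ-refl public

  on-→• : ∀ S φ′ ψ′ → ¬ (S ,∘ φ′) ≈ₛ T (S ,• (φ′ ⇒ ψ′)) → ¬ (S ,• ψ′) ≈ₛ T (S ,• (φ′ ⇒ ψ′))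
    → ⟨ [ φ ⇒ ψ ] ∣ [] ⟩ ⊑ₛ ⟨ [ φ ⇒ ψ ] ∣ [] ⟩ ∖ₛ ⟨ [ φ′ ⇒ ψ′ ] ∣ [] ⟩
  on-→• S φ′ ψ′ _ fresh with (φ′ ⇒ ψ′) ≟ (φ ⇒ ψ)
  ... | yes refl = contradiction (≈ₛ-sym (T-cancel S)) fresh
  ... | no other = ⊑-del-≢ other , []⊑

  admissible : Admissible
  admissible = record
    { on-Ax   = λ _ → ⊑ₛ-refl
    ; on-⊥•   = ⊑ₛ-refl
    ; on-→•   = on-→•
    ; on-→∘   = λ _ _ _ _ → ⊑ₛ-refl
    ; on-Refl = λ _ → ⊑ₛ-refl
    ; on-Box  = λ _ Π _ _ → BoxFree⇒⊑∖□* Π (λ _ → refl) , ⊑-refl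
    }

  open Sound admissible public

module Inversion→∘ (φ ψ : Fm) where
  open DeleteAdd ⟨ [] ∣ [ φ ⇒ ψ ] ⟩ ⟨ [] ∣ [ φ ⇒ ψ ] ⟩ ⟨ [ φ ] ∣ [ ψ ] ⟩ ⊑ₛ-refl public

  on-→∘ : ∀ S φ′ ψ′ → ¬ (S ,• φ′ ,∘ ψ′) ≈ₛ T (S ,∘ (φ′ ⇒ ψ′))
    → ⟨ [] ∣ [ φ ⇒ ψ ] ⟩ ⊑ₛ ⟨ [] ∣ [ φ ⇒ ψ ] ⟩ ∖ₛ ⟨ [] ∣ [ φ′ ⇒ ψ′ ] ⟩
  on-→∘ S φ′ ψ′ fresh with (φ′ ⇒ ψ′) ≟ (φ ⇒ ψ)
  ... | yes refl = contradiction (≈ₛ-sym (T-cancel S)) fresh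
  ... | no other = []⊑ , ⊑-del-≢ other

  admissible : Admissible
  admissible = record
    { on-Ax   = λ _ → ⊑ₛ-refl
    ; on-⊥•   = ⊑ₛ-refl
    ; on-→•   = λ _ _ _ _ _ → ⊑ₛ-refl
    ; on-→∘   = on-→∘
    ; on-Refl = λ _ → ⊑ₛ-refl
    ; on-Box  = λ _ _ _ _ → []⊑ , ⊑-refl
    }

  open Sound admissible public

module Inversion□∘ (φ : Fm) where
  open DeleteAdd ⟨ [] ∣ [ □ φ ] ⟩ ⟨ [] ∣ [ □ φ ] ⟩ ⟨ [] ∣ [ φ ] ⟩ ⊑ₛ-refl public

  on-Box : ∀ S Π φ′ → let S□ = S ∪ₛ ⟨ □* Π ∣ [] ⟩ in ¬ (S□ ,∘ φ′) ≈ₛ T (S□ ,∘ □ φ′)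
    → ⟨ [] ∣ [ □ φ ] ⟩ ⊑ₛ ⟨ [] ∣ [ □ φ ] ⟩ ∖ₛ ⟨ □* Π ∣ [ □ φ′ ] ⟩
  on-Box S Π φ′ fresh with □ φ′ ≟ □ φ
  ... | yes refl = contradiction (≈ₛ-sym (T-cancel (S ∪ₛ ⟨ □* Π ∣ [] ⟩))) fresh
  ... | no other = []⊑ , ⊑-del-≢ other

  admissible : Admissible
  admissible = record
    { on-Ax   = λ _ → ⊑ₛ-refl
    ; on-⊥•   = ⊑ₛ-refl
    ; on-→•   = λ _ _ _ _ _ → ⊑ₛ-refl
    ; on-→∘   = λ _ _ _ _ → ⊑ₛ-refl
    ; on-Refl = λ _ → ⊑ₛ-refl
    ; on-Box  = on-Box
    }

  open Sound admissible public

weakening-⊢ : ∀ S S′ π → π ⊢ S → Weakening.transform S′ π ⊢ (S ∪ₛ S′)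
weakening-⊢ S S′ π π⊢ = ≈ₛ-trans (Weakening.transform-∪ S′ π S π⊢ ∅⊑ₛ) (∪ₛ-comm S′ S)

contraction•-⊢ : ∀ S p π → π ⊢ S ,• var p ,• var p → Contraction•.transform p π ⊢ S ,• var p
contraction•-⊢ S p π π⊢ =
  Contraction•.transform-∪ p π (S ,• var p) π⊢ (⊑ₛ-∪ʳ ⟨ var p ∷ [ var p ] ∣ [] ⟩ S)

contraction∘-⊢ : ∀ S p π → π ⊢ S ,∘ var p ,∘ var p → Contraction∘.transform p π ⊢ S ,∘ var p
contraction∘-⊢ S p π π⊢ =
  Contraction∘.transform-∪ p π (S ,∘ var p) π⊢ (⊑ₛ-∪ʳ ⟨ [] ∣ var p ∷ [ var p ] ⟩ S)

inversion⊥∘-⊢ : ∀ S π → π ⊢ S ,∘ ⊥' → Inversion⊥∘.transform π ⊢ S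
inversion⊥∘-⊢ S π π⊢ = Inversion⊥∘.transform-∪ π S π⊢ (⊑ₛ-∪ʳ ⟨ [] ∣ [ ⊥' ] ⟩ S)

inversion→•-⊢ : ∀ S φ ψ π → π ⊢ S ,• (φ ⇒ ψ)
  → (LeftInversion→•.transform φ ψ π ⊢ S ,∘ φ) × (RightInversion→•.transform φ ψ π ⊢ S ,• ψ)
inversion→•-⊢ S φ ψ π π⊢ =
  LeftInversion→•.transform-∪ φ ψ π S π⊢ (⊑ₛ-∪ʳ ⟨ [ φ ⇒ ψ ] ∣ [] ⟩ S) ,
  RightInversion→•.transform-∪ φ ψ π S π⊢ (⊑ₛ-∪ʳ ⟨ [ φ ⇒ ψ ] ∣ [] ⟩ S)

inversion→∘-⊢ : ∀ S φ ψ π → π ⊢ S ,∘ (φ ⇒ ψ) → Inversion→∘.transform φ ψ π ⊢ S ,• φ ,∘ ψ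
inversion→∘-⊢ S φ ψ π π⊢ = Inversion→∘.transform-∪ φ ψ π S π⊢ (⊑ₛ-∪ʳ ⟨ [] ∣ [ φ ⇒ ψ ] ⟩ S)

inversion□∘-⊢ : ∀ S φ π → π ⊢ S ,∘ □ φ → Inversion□∘.transform φ π ⊢ S ,∘ φ
inversion□∘-⊢ S φ π π⊢ = Inversion□∘.transform-∪ φ π S π⊢ (⊑ₛ-∪ʳ ⟨ [] ∣ [ □ φ ] ⟩ S)

lemma4p3 :
    Σ (Sequent → Proof → Proof) λ wk →
    Σ (ℕ → Proof → Proof) λ contr• →
    Σ (ℕ → Proof → Proof) λ contr∘ →
    Σ (Proof → Proof) λ inv⊥∘ →
    Σ (Fm → Fm → Proof → Proof) λ linv→• →
    Σ (Fm → Fm → Proof → Proof) λ rinv→• →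
    Σ (Fm → Fm → Proof → Proof) λ inv→∘ →
    Σ (Fm → Proof → Proof) λ inv□∘ →
      -- (i)
      (∀ S S' π → π ⊢ S → wk S' π ⊢ S ∪ₛ S')
      -- (ii)
    × (∀ S p π → π ⊢ S ,• var p ,• var p → contr• p π ⊢ S ,• var p)
      -- (iii)
    × (∀ S p π → π ⊢ S ,∘ var p ,∘ var p → contr∘ p π ⊢ S ,∘ var p)
      -- (iv)
    × (∀ S π → π ⊢ S ,∘ ⊥' → inv⊥∘ π ⊢ S)
      -- (v)
    × (∀ S φ ψ π → π ⊢ S ,• (φ ⇒ ψ)
         → (linv→• φ ψ π ⊢ S ,∘ φ) × (rinv→• φ ψ π ⊢ S ,• ψ))
      -- (vi)
    × (∀ S φ ψ π → π ⊢ S ,∘ (φ ⇒ ψ) → inv→∘ φ ψ π ⊢ S ,• φ ,∘ ψ)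
      -- (vii)
    × (∀ S φ π → π ⊢ S ,∘ □ φ → inv□∘ φ π ⊢ S ,∘ φ)
      -- (viii)
    × (∀ S' → Preserves (wk S'))
    × (∀ p → Preserves (contr• p))
    × (∀ p → Preserves (contr∘ p))
    × Preserves inv⊥∘
    × (∀ φ ψ → Preserves (linv→• φ ψ))
    × (∀ φ ψ → Preserves (rinv→• φ ψ))
    × (∀ φ ψ → Preserves (inv→∘ φ ψ))
    × (∀ φ → Preserves (inv□∘ φ))
lemma4p3 =
  Weakening.transform , Contraction•.transform , Contraction∘.transform , Inversion⊥∘.transform ,
  LeftInversion→•.transform , RightInversion→•.transform , Inversion→∘.transform , Inversion□∘.transform ,
  weakening-⊢ , contraction•-⊢ , contraction∘-⊢ , inversion⊥∘-⊢ ,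
  inversion→•-⊢ , inversion→∘-⊢ , inversion□∘-⊢ ,
  Weakening.transform-preserves , Contraction•.transform-preserves , Contraction∘.transform-preserves ,
  Inversion⊥∘.transform-preserves , LeftInversion→•.transform-preserves , RightInversion→•.transform-preserves ,
  Inversion→∘.transform-preserves , Inversion□∘.transform-preserves
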